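{- For every integer $j \geq 10$ there is no positive integer $n$ with $p^2(n,j) = 3$; that is, no positive integer can be expressed as the sum of exactly $j$ positive squares in exactly $3$ ways when $j \ge 10$.
   Context: For positive integers $k, j$ and a nonnegative integer $n$, $p^k(n,j)$ denotes the number of partitions of $n$ into exactly $j$ parts, each part a positive $k$-th power; equivalently, the number of multisets $\{x_1,\dots,x_j\}$ of positive integers (order of summands ignored) with $x_1^k+\cdots+x_j^k = n$. -}

module Defs where

open import Data.Nat using (ℕ; zero; suc; _+_; _^_; _≟_)
open import Data.List using (List; []; _∷_; map; filter; length)
open import Data.Nat.ListAction using (sum)

-- Multisets of positive integers are represented canonically as
-- non-increasing lists.  `nonincLists j m` enumerates every non-increasing
-- list of exactly j positive integers, all of them ≤ m (each exactly once).
nonincLists : ℕ → ℕ → List (List ℕ)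
nonincLists zero    m = [] ∷ []
nonincLists (suc j) zero = []
nonincLists (suc j) (suc m) =
  nonincLists (suc j) m ++′ map (suc m ∷_) (nonincLists j (suc m))
  where
  open import Data.List using () renaming (_++_ to _++′_)

powSum : ℕ → List ℕ → ℕ
powSum k xs = sum (map (λ x → x ^ k) xs)

-- p^k(n,j): number of multisets {x₁,…,x_j} of positive integers with
-- x₁^k + ⋯ + x_j^k = n.  For k ≥ 1 every part satisfies x ≤ x^k ≤ n,
-- so enumerating parts in [1..n] loses nothing.
p : ℕ → ℕ → ℕ → ℕ
p k n j = length (filter (λ xs → powSum k xs ≟ n) (nonincLists j n))

-- A partition of n into j positive squares x₁, …, x_j has excess
-- m = Σ (xᵢ² - 1), to which every part xᵢ ≥ 2 contributes at least 3. For m ≤ 42 no part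
-- exceeds 6 and at most 14 parts exceed 1, so deleting parts equal to 1 identifies the
-- count for any j ≥ 14 with the count for j = 14, and the cases 10 ≤ j ≤ 14, m ≤ 42 are
-- settled by evaluating a recursion for p. For m ≥ 43, Lagrange's four-square theorem
-- writes m - 43 as a sum of k ≤ 4 positive squares; adding j - 10 ones and any of four
-- different choices of 10 - k positive parts with squares summing to 53 gives four
-- partitions. Lagrange's theorem is proved by Euler's identity and descent, starting from a
-- multiple of p of the form x² + y² + 1 found by pigeonhole among the squares modulo p.

{-# OPTIONS --safe #-}
module Submission where

open import Defs
open import Data.Nat using (ℕ; _≤_)
open import Relation.Binary.PropositionalEquality using (_≢_)

module SquaresModuloOddPrime where

  open import Data.Nat.Base
  open import Data.Nat.Properties
  open import Data.Nat.DivMod using (_%_; _/_; _mod_; m≡m%n+[m/n]*n; [m+kn]%n≡m%n; m*n%n≡0; %-distribˡ-+)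
  open import Data.Nat.Divisibility using (_∣_; divides; ∣⇒≤; m%n≡0⇒n∣m)
  open import Data.Nat.Primality using (Prime; euclidsLemma)
  open import Data.Nat.Tactic.RingSolver using (solve-∀)
  open import Data.Fin.Base using (Fin; toℕ; splitAt; join)
  open import Data.Fin.Properties using (pigeonhole; toℕ-fromℕ<; toℕ-injective; toℕ≤pred[n]; join-splitAt)
  import Data.Fin.Properties as Fin
  open import Data.Product using (∃₂; _×_; _,_)
  open import Data.Sum using (_⊎_; inj₁; inj₂)
  open import Data.Empty using (⊥-elim)
  open import Relation.Binary.Definitions using (tri<; tri≈; tri>)
  open import Relation.Binary.PropositionalEquality
  open import Function using (_∘_)

  %-≡⇒∣∸ : ∀ {a b} n .{{_ : NonZero n}} → a % n ≡ b % n → n ∣ b ∸ a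
  %-≡⇒∣∸ {a} {b} n a≡b = divides (b / n ∸ a / n) (begin
    b ∸ a                                     ≡⟨ cong₂ _∸_ (m≡m%n+[m/n]*n b n) (m≡m%n+[m/n]*n a n) ⟩
    (b % n + b / n * n) ∸ (a % n + a / n * n) ≡⟨ cong (λ r → (b % n + b / n * n) ∸ (r + a / n * n)) a≡b ⟩
    (b % n + b / n * n) ∸ (b % n + a / n * n) ≡⟨ [m+n]∸[m+o]≡n∸o (b % n) _ _ ⟩
    b / n * n ∸ a / n * n                     ≡⟨ sym (*-distribʳ-∸ n (b / n) (a / n)) ⟩
    (b / n ∸ a / n) * n                       ∎)
    where open ≡-Reasoning

  %-≡-+ʳ : ∀ a b c n .{{_ : NonZero n}} → a % n ≡ b % n → (a + c) % n ≡ (b + c) % n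
  %-≡-+ʳ a b c n a≡b = begin
    (a + c) % n           ≡⟨ %-distribˡ-+ a c n ⟩
    (a % n + c % n) % n   ≡⟨ cong (λ r → (r + c % n) % n) a≡b ⟩
    (b % n + c % n) % n   ≡⟨ %-distribˡ-+ b c n ⟨
    (b + c) % n           ∎
    where open ≡-Reasoning

  module OddPrime {h : ℕ} (p-prime : Prime (suc (h + h))) where

    p′ : ℕ
    p′ = suc (h + h)

    squares-incongruent : ∀ c {x x′} → x < x′ → x′ ≤ h → (c + x * x) % p′ ≢ (c + x′ * x′) % p′
    squares-incongruent c {x} x<x′ x′≤h eq with d , refl ← m≤n⇒∃[o]m+o≡n (<⇒≤ x<x′)
      with euclidsLemma d (x + d + x) p-prime p∣d[2x+d]
      where
      expand : ∀ c x d → c + (x + d) * (x + d) ≡ (c + x * x) + d * (x + d + x)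
      expand = solve-∀
      p∣d[2x+d] : p′ ∣ d * (x + d + x)
      p∣d[2x+d] = subst (p′ ∣_) (trans (cong (_∸ (c + x * x)) (expand c x d)) (m+n∸m≡n (c + x * x) _))
                    (%-≡⇒∣∸ {c + x * x} {c + (x + d) * (x + d)} p′ eq)
    ... | inj₁ p∣d = <⇒≱ (s≤s (≤-trans (m≤n+m d x) (≤-trans x′≤h (m≤m+n h h)))) (∣⇒≤ {{>-nonZero d>0}} p∣d)
      where
      d>0 : 0 < d
      d>0 = +-cancelˡ-< x 0 d (subst (_< x + d) (sym (+-identityʳ x)) x<x′)
    ... | inj₂ p∣2x+d = <⇒≱ (s≤s (+-mono-≤ x′≤h (≤-trans (m≤m+n x d) x′≤h))) (∣⇒≤ {{>-nonZero 2x+d>0}} p∣2x+d)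
      where
      2x+d>0 : 0 < x + d + x
      2x+d>0 = ≤-trans (s≤s z≤n) (≤-trans x<x′ (m≤m+n (x + d) x))

    -- h + h ≡ -1 (mod p′), so the right-hand residues are those of -(1 + l²)
    residue : Fin (suc h) ⊎ Fin (suc h) → ℕ
    residue (inj₁ x) = toℕ x * toℕ x
    residue (inj₂ l) = (h + h) * suc (toℕ l * toℕ l)

    Fin-squares-incongruent : ∀ c {x x′ : Fin (suc h)} → x ≢ x′ → (c + toℕ x * toℕ x) % p′ ≢ (c + toℕ x′ * toℕ x′) % p′
    Fin-squares-incongruent c {x} {x′} x≢x′ with <-cmp (toℕ x) (toℕ x′)
    ... | tri< x<x′ _ _ = squares-incongruent c x<x′ (toℕ≤pred[n] x′)
    ... | tri≈ _ x≡x′ _ = ⊥-elim (x≢x′ (toℕ-injective x≡x′))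
    ... | tri> _ _ x′<x = squares-incongruent c x′<x (toℕ≤pred[n] x) ∘ sym

    [h+h]*-cancel-% : ∀ a b → (h + h) * a % p′ ≡ (h + h) * b % p′ → a % p′ ≡ b % p′
    [h+h]*-cancel-% a b eq = begin
      a % p′                        ≡⟨ [m+kn]%n≡m%n a b p′ ⟨
      (a + b * p′) % p′             ≡⟨ cong (_% p′) (identity h a b) ⟩
      ((h + h) * b + (b + a)) % p′  ≡⟨ %-≡-+ʳ ((h + h) * a) ((h + h) * b) (b + a) p′ eq ⟨
      ((h + h) * a + (b + a)) % p′  ≡⟨ cong (_% p′) (trans (identity h b a) (cong ((h + h) * a +_) (+-comm a b))) ⟨
      (b + a * p′) % p′             ≡⟨ [m+kn]%n≡m%n b a p′ ⟩
      b % p′                        ∎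
      where
      open ≡-Reasoning
      identity : ∀ h a b → a + b * suc (h + h) ≡ (h + h) * b + (b + a)
      identity = solve-∀

    x²≡[h+h]a⇒p∣x²+a : ∀ x a → x * x % p′ ≡ (h + h) * a % p′ → p′ ∣ x * x + a
    x²≡[h+h]a⇒p∣x²+a x a eq = m%n≡0⇒n∣m _ p′ (trans (%-≡-+ʳ (x * x) ((h + h) * a) a p′ eq)
                                            (trans (cong (_% p′) (identity h a)) (m*n%n≡0 a p′)))
      where
      identity : ∀ h a → (h + h) * a + a ≡ a * suc (h + h)
      identity = solve-∀

    collision : ∀ u v → u ≢ v → residue u % p′ ≡ residue v % p′ → ∃₂ λ x l → x ≤ h × l ≤ h × p′ ∣ x * x + suc (l * l)
    collision (inj₁ x) (inj₁ x′) u≢v eq = ⊥-elim (Fin-squares-incongruent 0 (u≢v ∘ cong inj₁) eq)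
    collision (inj₂ l) (inj₂ l′) u≢v eq =
      ⊥-elim (Fin-squares-incongruent 1 (u≢v ∘ cong inj₂) ([h+h]*-cancel-% (suc (toℕ l * toℕ l)) _ eq))
    collision (inj₁ x) (inj₂ l) _ eq = toℕ x , toℕ l , toℕ≤pred[n] x , toℕ≤pred[n] l , x²≡[h+h]a⇒p∣x²+a (toℕ x) _ eq
    collision (inj₂ l) (inj₁ x) _ eq = toℕ x , toℕ l , toℕ≤pred[n] x , toℕ≤pred[n] l , x²≡[h+h]a⇒p∣x²+a (toℕ x) _ (sym eq)

    x²+y²+1-divisible : ∃₂ λ x y → x ≤ h × y ≤ h × p′ ∣ x * x + suc (y * y)
    x²+y²+1-divisible =
      let i , j , i<j , fi≡fj = pigeonhole (s≤s (+-monoʳ-< h (n<1+n h))) (λ i → residue (splitAt (suc h) i) mod p′)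
      in collision (splitAt (suc h) i) (splitAt (suc h) j) (splitAt-injective (Fin.<⇒≢ i<j))
           (trans (sym (toℕ-fromℕ< _)) (trans (cong toℕ fi≡fj) (toℕ-fromℕ< _)))
      where
      splitAt-injective : ∀ {i j} → i ≢ j → splitAt (suc h) {suc h} i ≢ splitAt (suc h) j
      splitAt-injective {i} {j} i≢j eq =
        i≢j (trans (sym (join-splitAt (suc h) (suc h) i)) (trans (cong (join (suc h) (suc h)) eq) (join-splitAt (suc h) (suc h) j)))

module FourSquareTheorem where

  open import Data.Nat.Base as ℕ using (ℕ; zero; suc; z≤n; s≤s; NonZero)
  import Data.Nat.Properties as ℕₚ
  open import Data.Nat.Divisibility using (_∣_; divides)
  open import Data.Nat.Primality using (Prime; prime⇒irreducible; ¬prime[1])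
  open import Data.Nat.Primality.Factorisation using (factorise; PrimeFactorisation)
  open PrimeFactorisation using (isFactorisation; factorsPrime)
  open import Data.Nat.ListAction using (product)
  open import Data.List.Base using (_∷_)
  open import Data.List.Relation.Unary.All using (All; []; _∷_)
  open import Data.Integer.Base using (ℤ; +_; -[1+_]; _+_; _*_; _-_; -_; ∣_∣; 0ℤ; 1ℤ)
  open import Data.Integer.Properties
    using (*-identityˡ; *-cancelˡ-≡; pos-+; pos-*; +-injective; abs-*; ∣-i∣≡∣i∣; ∣i∣≡0⇒i≡0)
  open import Data.Integer.DivMod using (_/_; _%_; a≡a%n+[a/n]*n; n%d<d)
  open import Data.Integer.Solver using (module +-*-Solver)
  open import Data.Nat.Tactic.RingSolver using () renaming (solve-∀ to ℕ-solve-∀)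
  open import Data.Product using (proj₂; ∃₂; ∃-syntax; _×_; _,_)
  open import Data.Sum using (_⊎_; inj₁; inj₂)
  open import Data.Empty using (⊥; ⊥-elim)
  open import Relation.Binary.Definitions using (tri<; tri≈; tri>)
  open import Relation.Binary.PropositionalEquality
  open import Data.Nat.Induction using (<-rec)
  open import Function using (case_of_)
  open SquaresModuloOddPrime.OddPrime using (x²+y²+1-divisible)

  open +-*-Solver using (solve; _:=_; _:+_; _:*_; _:-_; :-_; con; Polynomial)

  sumSq : ℤ → ℤ → ℤ → ℤ → ℤ
  sumSq a b c d = a * a + b * b + c * c + d * d

  sumSqᴾ : ∀ {k} → Polynomial k → Polynomial k → Polynomial k → Polynomial k → Polynomial k
  sumSqᴾ a b c d = a :* a :+ b :* b :+ c :* c :+ d :* d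

  record FourSquares (n : ℤ) : Set where
    constructor fourSquares
    field
      a b c d : ℤ
      sumSq≡ : sumSq a b c d ≡ n

  -- Euler's four-square identity
  fourSquares-* : ∀ {m n} → FourSquares m → FourSquares n → FourSquares (m * n)
  fourSquares-* (fourSquares a₁ a₂ a₃ a₄ refl) (fourSquares b₁ b₂ b₃ b₄ refl) =
    fourSquares (a₁ * b₁ + a₂ * b₂ + a₃ * b₃ + a₄ * b₄) (a₁ * b₂ - a₂ * b₁ + a₃ * b₄ - a₄ * b₃)
                (a₁ * b₃ - a₃ * b₁ + a₄ * b₂ - a₂ * b₄) (a₁ * b₄ - a₄ * b₁ + a₂ * b₃ - a₃ * b₂)
      (solve 8 (λ a₁ a₂ a₃ a₄ b₁ b₂ b₃ b₄ →
        sumSqᴾ (a₁ :* b₁ :+ a₂ :* b₂ :+ a₃ :* b₃ :+ a₄ :* b₄) (a₁ :* b₂ :- a₂ :* b₁ :+ a₃ :* b₄ :- a₄ :* b₃)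
               (a₁ :* b₃ :- a₃ :* b₁ :+ a₄ :* b₂ :- a₂ :* b₄) (a₁ :* b₄ :- a₄ :* b₁ :+ a₂ :* b₃ :- a₃ :* b₂)
        := sumSqᴾ a₁ a₂ a₃ a₄ :* sumSqᴾ b₁ b₂ b₃ b₄) refl a₁ a₂ a₃ a₄ b₁ b₂ b₃ b₄)

  sumSq-cong : ∀ {a b c d a′ b′ c′ d′} → a ≡ a′ → b ≡ b′ → c ≡ c′ → d ≡ d′ → sumSq a b c d ≡ sumSq a′ b′ c′ d′
  sumSq-cong refl refl refl refl = refl

  sumSqℕ : ℕ → ℕ → ℕ → ℕ → ℕ
  sumSqℕ a b c d = a ℕ.* a ℕ.+ b ℕ.* b ℕ.+ c ℕ.* c ℕ.+ d ℕ.* d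

  sumSq≡sumSqℕ∣∣ : ∀ a b c d → sumSq a b c d ≡ + sumSqℕ (∣ a ∣) (∣ b ∣) (∣ c ∣) (∣ d ∣)
  sumSq≡sumSqℕ∣∣ a b c d =
    trans (cong₂ _+_ (cong₂ _+_ (cong₂ _+_ (square a) (square b)) (square c)) (square d))
          (sym (trans (pos-+ (A ℕ.+ B ℕ.+ C) D) (cong (_+ + D) (trans (pos-+ (A ℕ.+ B) C) (cong (_+ + C) (pos-+ A B))))))
    where
    square : ∀ a → a * a ≡ + (∣ a ∣ ℕ.* ∣ a ∣)
    square (+ n) = sym (pos-* n n)
    square -[1+ n ] = refl
    A B C D : ℕ
    A = ∣ a ∣ ℕ.* ∣ a ∣
    B = ∣ b ∣ ℕ.* ∣ b ∣
    C = ∣ c ∣ ℕ.* ∣ c ∣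
    D = ∣ d ∣ ℕ.* ∣ d ∣

  quadruple-sumSqℕ : ∀ a b c d → 4 ℕ.* sumSqℕ a b c d ≡ sumSqℕ (2 ℕ.* a) (2 ℕ.* b) (2 ℕ.* c) (2 ℕ.* d)
  quadruple-sumSqℕ = identity
    where
    identity : ∀ a b c d → 4 ℕ.* (a ℕ.* a ℕ.+ b ℕ.* b ℕ.+ c ℕ.* c ℕ.+ d ℕ.* d) ≡
      (2 ℕ.* a) ℕ.* (2 ℕ.* a) ℕ.+ (2 ℕ.* b) ℕ.* (2 ℕ.* b) ℕ.+ (2 ℕ.* c) ℕ.* (2 ℕ.* c) ℕ.+ (2 ℕ.* d) ℕ.* (2 ℕ.* d)
    identity = ℕ-solve-∀

  square-mono-≤ : ∀ {x y} → x ℕ.≤ y → x ℕ.* x ℕ.≤ y ℕ.* y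
  square-mono-≤ x≤y = ℕₚ.*-mono-≤ x≤y x≤y

  sumSqℕ-≤ : ∀ {a b c d m} → a ℕ.≤ m → b ℕ.≤ m → c ℕ.≤ m → d ℕ.≤ m → sumSqℕ a b c d ℕ.≤ sumSqℕ m m m m
  sumSqℕ-≤ a≤m b≤m c≤m d≤m =
    ℕₚ.+-mono-≤ (ℕₚ.+-mono-≤ (ℕₚ.+-mono-≤ (square-mono-≤ a≤m) (square-mono-≤ b≤m)) (square-mono-≤ c≤m)) (square-mono-≤ d≤m)

  sumSqℕ-diagonal : ∀ m → sumSqℕ m m m m ≡ 4 ℕ.* (m ℕ.* m)
  sumSqℕ-diagonal = identity
    where
    identity : ∀ m → m ℕ.* m ℕ.+ m ℕ.* m ℕ.+ m ℕ.* m ℕ.+ m ℕ.* m ≡ 4 ℕ.* (m ℕ.* m)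
    identity = ℕ-solve-∀

  +-≤-≡ : ∀ {a b x y} → a ℕ.≤ x → b ℕ.≤ y → a ℕ.+ b ≡ x ℕ.+ y → a ≡ x × b ≡ y
  +-≤-≡ a≤x b≤y a+b≡x+y with ℕₚ.m≤n⇒m<n∨m≡n a≤x | ℕₚ.m≤n⇒m<n∨m≡n b≤y
  ... | inj₂ a≡x | inj₂ b≡y = a≡x , b≡y
  ... | inj₁ a<x | _ = ⊥-elim (ℕₚ.<-irrefl a+b≡x+y (ℕₚ.+-mono-<-≤ a<x b≤y))
  ... | _ | inj₁ b<y = ⊥-elim (ℕₚ.<-irrefl a+b≡x+y (ℕₚ.+-mono-≤-< a≤x b<y))

  sumSqℕ-≡ : ∀ {a b c d m} → a ℕ.≤ m → b ℕ.≤ m → c ℕ.≤ m → d ℕ.≤ m → sumSqℕ a b c d ≡ sumSqℕ m m m m →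
             a ≡ m × b ≡ m × c ≡ m × d ≡ m
  sumSqℕ-≡ a≤m b≤m c≤m d≤m S≡ =
    let abc≡ , dd≡ = +-≤-≡ (ℕₚ.+-mono-≤ (ℕₚ.+-mono-≤ (square-mono-≤ a≤m) (square-mono-≤ b≤m)) (square-mono-≤ c≤m))
                           (square-mono-≤ d≤m) S≡
        ab≡ , cc≡ = +-≤-≡ (ℕₚ.+-mono-≤ (square-mono-≤ a≤m) (square-mono-≤ b≤m)) (square-mono-≤ c≤m) abc≡
        aa≡ , bb≡ = +-≤-≡ (square-mono-≤ a≤m) (square-mono-≤ b≤m) ab≡
    in root a≤m aa≡ , root b≤m bb≡ , root c≤m cc≡ , root d≤m dd≡
    where
    root : ∀ {x y} → x ℕ.≤ y → x ℕ.* x ≡ y ℕ.* y → x ≡ y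
    root x≤y xx≡yy with ℕₚ.m≤n⇒m<n∨m≡n x≤y
    ... | inj₁ x<y = ⊥-elim (ℕₚ.<-irrefl xx≡yy (ℕₚ.*-mono-< x<y x<y))
    ... | inj₂ x≡y = x≡y

  sumSqℕ≡0 : ∀ {a b c d} → sumSqℕ a b c d ≡ 0 → a ≡ 0 × b ≡ 0 × c ≡ 0 × d ≡ 0
  sumSqℕ≡0 {a} {b} {c} S≡0 =
    root (ℕₚ.m+n≡0⇒m≡0 _ (ℕₚ.m+n≡0⇒m≡0 _ (ℕₚ.m+n≡0⇒m≡0 _ S≡0))) ,
    root (ℕₚ.m+n≡0⇒n≡0 (a ℕ.* a) (ℕₚ.m+n≡0⇒m≡0 _ (ℕₚ.m+n≡0⇒m≡0 _ S≡0))) ,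
    root (ℕₚ.m+n≡0⇒n≡0 (a ℕ.* a ℕ.+ b ℕ.* b) (ℕₚ.m+n≡0⇒m≡0 _ S≡0)) ,
    root (ℕₚ.m+n≡0⇒n≡0 (a ℕ.* a ℕ.+ b ℕ.* b ℕ.+ c ℕ.* c) S≡0)
    where
    root : ∀ {x} → x ℕ.* x ≡ 0 → x ≡ 0
    root {zero} _ = refl

  Centred : ℕ → ℤ → Set
  Centred m y = 2 ℕ.* ∣ y ∣ ℕ.< m ⊎ + 2 * y ≡ + m

  centred-residue : ∀ x m .{{_ : NonZero m}} → ∃₂ λ q y → x ≡ y + q * + m × Centred m y
  centred-residue x m = centre m (x % + m) (x / + m) (n%d<d x (+ m)) (a≡a%n+[a/n]*n x (+ m))
    where
    centre : ∀ {x} m r q → r ℕ.< m → x ≡ + r + q * + m → ∃₂ λ q y → x ≡ y + q * + m × Centred m y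
    centre {x} m r q r<m x≡ with ℕₚ.<-cmp (2 ℕ.* r) m
    ... | tri< 2r<m _ _ = q , + r , x≡ , inj₁ 2r<m
    ... | tri≈ _ 2r≡m _ = q , + r , x≡ , inj₂ (trans (sym (pos-* 2 r)) (cong +_ 2r≡m))
    ... | tri> _ _ 2r>m with d , refl ← ℕₚ.m≤n⇒∃[o]m+o≡n (ℕₚ.<⇒≤ r<m) =
      q + 1ℤ , - + d , trans x≡ (trans (cong (λ m → + r + q * m) (pos-+ r d)) (shift (+ r) (+ d) q)) ,
      inj₁ (subst (λ e → 2 ℕ.* e ℕ.< r ℕ.+ d) (sym (∣-i∣≡∣i∣ (+ d))) 2d<r+d)
      where
      shift : ∀ r d q → r + q * (r + d) ≡ - d + (q + 1ℤ) * (r + d)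
      shift = solve 3 (λ r d q → r :+ q :* (r :+ d) := :- d :+ (q :+ con 1ℤ) :* (r :+ d)) refl
      2d<r+d : 2 ℕ.* d ℕ.< r ℕ.+ d
      twice : ∀ n → 2 ℕ.* n ≡ n ℕ.+ n
      twice n = cong (n ℕ.+_) (ℕₚ.+-identityʳ n)
      2d<r+d = subst (ℕ._< r ℕ.+ d) (sym (twice d))
                 (ℕₚ.+-monoˡ-< d (ℕₚ.+-cancelˡ-< r d r (subst (r ℕ.+ d ℕ.<_) (twice r) 2r>m)))

  centred-≤ : ∀ {m y} → Centred m y → 2 ℕ.* ∣ y ∣ ℕ.≤ m
  centred-≤ (inj₁ 2∣y∣<m) = ℕₚ.<⇒≤ 2∣y∣<m
  centred-≤ {y = y} (inj₂ 2y≡m) = ℕₚ.≤-reflexive (trans (sym (abs-* (+ 2) y)) (cong ∣_∣ 2y≡m))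

  centred-tight : ∀ {m y} → Centred m y → 2 ℕ.* ∣ y ∣ ≡ m → + 2 * y ≡ + m
  centred-tight (inj₁ 2∣y∣<m) 2∣y∣≡m = ⊥-elim (ℕₚ.<-irrefl 2∣y∣≡m 2∣y∣<m)
  centred-tight (inj₂ 2y≡m) _ = 2y≡m

  sumSq-double : ∀ {n} y₁ y₂ y₃ y₄ → sumSq y₁ y₂ y₃ y₄ ≡ + n →
    sumSqℕ (2 ℕ.* ∣ y₁ ∣) (2 ℕ.* ∣ y₂ ∣) (2 ℕ.* ∣ y₃ ∣) (2 ℕ.* ∣ y₄ ∣) ≡ 4 ℕ.* n
  sumSq-double y₁ y₂ y₃ y₄ Sy≡ =
    trans (sym (quadruple-sumSqℕ (∣ y₁ ∣) (∣ y₂ ∣) (∣ y₃ ∣) (∣ y₄ ∣)))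
          (cong (4 ℕ.*_) (+-injective (trans (sym (sumSq≡sumSqℕ∣∣ y₁ y₂ y₃ y₄)) Sy≡)))

  residue-trichotomy : ∀ {m r y₁ y₂ y₃ y₄} .{{_ : NonZero m}} →
    Centred m y₁ → Centred m y₂ → Centred m y₃ → Centred m y₄ → sumSq y₁ y₂ y₃ y₄ ≡ + (m ℕ.* r) →
    (y₁ ≡ 0ℤ × y₂ ≡ 0ℤ × y₃ ≡ 0ℤ × y₄ ≡ 0ℤ) ⊎
    (+ 2 * y₁ ≡ + m × + 2 * y₂ ≡ + m × + 2 * y₃ ≡ + m × + 2 * y₄ ≡ + m) ⊎
    (1 ℕ.≤ r × r ℕ.< m)
  residue-trichotomy {m} {zero} {y₁} {y₂} {y₃} {y₄} _ _ _ _ Sy≡ =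
    let z₁ , z₂ , z₃ , z₄ =
          sumSqℕ≡0 (trans (+-injective (trans (sym (sumSq≡sumSqℕ∣∣ y₁ y₂ y₃ y₄)) Sy≡)) (ℕₚ.*-zeroʳ m))
    in inj₁ (∣i∣≡0⇒i≡0 z₁ , ∣i∣≡0⇒i≡0 z₂ , ∣i∣≡0⇒i≡0 z₃ , ∣i∣≡0⇒i≡0 z₄)
  residue-trichotomy {m} {suc r} {y₁} {y₂} {y₃} {y₄} c₁ c₂ c₃ c₄ Sy≡ with ℕₚ.<-cmp (suc r) m
  ... | tri< r<m _ _ = inj₂ (inj₂ (s≤s z≤n , r<m))
  ... | tri≈ _ refl _ =
    let t₁ , t₂ , t₃ , t₄ = sumSqℕ-≡ (centred-≤ c₁) (centred-≤ c₂) (centred-≤ c₃) (centred-≤ c₄)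
                              (trans (sumSq-double y₁ y₂ y₃ y₄ Sy≡) (sym (sumSqℕ-diagonal m)))
    in inj₂ (inj₁ (centred-tight c₁ t₁ , centred-tight c₂ t₂ , centred-tight c₃ t₃ , centred-tight c₄ t₄))
  ... | tri> _ _ m<r = ⊥-elim (ℕₚ.<⇒≱ (ℕₚ.*-monoʳ-< 4 (ℕₚ.*-monoʳ-< m m<r)) (begin
    4 ℕ.* (m ℕ.* suc r)
      ≡⟨ sym (sumSq-double y₁ y₂ y₃ y₄ Sy≡) ⟩
    sumSqℕ (2 ℕ.* ∣ y₁ ∣) (2 ℕ.* ∣ y₂ ∣) (2 ℕ.* ∣ y₃ ∣) (2 ℕ.* ∣ y₄ ∣)
      ≤⟨ sumSqℕ-≤ (centred-≤ c₁) (centred-≤ c₂) (centred-≤ c₃) (centred-≤ c₄) ⟩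
    sumSqℕ m m m m
      ≡⟨ sumSqℕ-diagonal m ⟩
    4 ℕ.* (m ℕ.* m) ∎))
    where open ℕₚ.≤-Reasoning

  nonneg≢m*neg : ∀ {n m k} → 1 ℕ.≤ m → + n ≢ + m * -[1+ k ]
  nonneg≢m*neg (s≤s _) ()

  m*p≢m*[m*k] : ∀ {m p} → Prime p → 2 ℕ.≤ m → m ℕ.< p → ∀ k → + m * + p ≢ + m * (+ m * k)
  m*p≢m*[m*k] {m@(suc (suc _))} {p} p-prime (s≤s (s≤s _)) m<p k mp≡mmk
    with prime⇒irreducible p-prime {m} (divides ∣ k ∣ p≡∣k∣*m)
    where
    p≡∣k∣*m : p ≡ ∣ k ∣ ℕ.* m
    p≡∣k∣*m = trans (cong ∣_∣ (*-cancelˡ-≡ (+ m) (+ p) (+ m * k) mp≡mmk))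
                    (trans (abs-* (+ m) k) (ℕₚ.*-comm m ∣ k ∣))
  ... | inj₁ ()
  ... | inj₂ refl = ℕₚ.<-irrefl refl m<p

  sumSq-of-multiples : ∀ {y₁ y₂ y₃ y₄} m q₁ q₂ q₃ q₄ → y₁ ≡ 0ℤ → y₂ ≡ 0ℤ → y₃ ≡ 0ℤ → y₄ ≡ 0ℤ →
    sumSq (y₁ + q₁ * m) (y₂ + q₂ * m) (y₃ + q₃ * m) (y₄ + q₄ * m) ≡ m * (m * sumSq q₁ q₂ q₃ q₄)
  sumSq-of-multiples m q₁ q₂ q₃ q₄ refl refl refl refl = solve 5 (λ m q₁ q₂ q₃ q₄ →
    sumSqᴾ (con 0ℤ :+ q₁ :* m) (con 0ℤ :+ q₂ :* m) (con 0ℤ :+ q₃ :* m) (con 0ℤ :+ q₄ :* m)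
    := m :* (m :* sumSqᴾ q₁ q₂ q₃ q₄)) refl m q₁ q₂ q₃ q₄

  sumSq-of-odd-multiples-of-half : ∀ {y₁ y₂ y₃ y₄ m} q₁ q₂ q₃ q₄ →
    + 2 * y₁ ≡ m → + 2 * y₂ ≡ m → + 2 * y₃ ≡ m → + 2 * y₄ ≡ m →
    ∃[ k ] sumSq (y₁ + q₁ * m) (y₂ + q₂ * m) (y₃ + q₃ * m) (y₄ + q₄ * m) ≡ m * (m * k)
  sumSq-of-odd-multiples-of-half {h} q₁ q₂ q₃ q₄ refl e₂ e₃ e₄
    with refl ← *-cancelˡ-≡ (+ 2) _ h e₂ | refl ← *-cancelˡ-≡ (+ 2) _ h e₃ | refl ← *-cancelˡ-≡ (+ 2) _ h e₄ =
    q₁ * q₁ + q₁ + (q₂ * q₂ + q₂) + (q₃ * q₃ + q₃) + (q₄ * q₄ + q₄) + 1ℤ ,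
    solve 5 (λ h q₁ q₂ q₃ q₄ →
      sumSqᴾ (h :+ q₁ :* (con (+ 2) :* h)) (h :+ q₂ :* (con (+ 2) :* h))
             (h :+ q₃ :* (con (+ 2) :* h)) (h :+ q₄ :* (con (+ 2) :* h))
      := con (+ 2) :* h :* (con (+ 2) :* h :*
           (q₁ :* q₁ :+ q₁ :+ (q₂ :* q₂ :+ q₂) :+ (q₃ :* q₃ :+ q₃) :+ (q₄ :* q₄ :+ q₄) :+ con 1ℤ))) refl h q₁ q₂ q₃ q₄

  residues-sumSq-divisible : ∀ m p y₁ y₂ y₃ y₄ q₁ q₂ q₃ q₄ →
    sumSq (y₁ + q₁ * m) (y₂ + q₂ * m) (y₃ + q₃ * m) (y₄ + q₄ * m) ≡ m * p →
    ∃[ R ] sumSq y₁ y₂ y₃ y₄ ≡ m * R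
  residues-sumSq-divisible m p y₁ y₂ y₃ y₄ q₁ q₂ q₃ q₄ Sx≡ = p - c , (begin
    Sy                ≡⟨ solve 3 (λ Sy m c → Sy := Sy :+ m :* c :- m :* c) refl Sy m c ⟩
    Sy + m * c - m * c ≡⟨ cong (_- m * c) (trans (sym (expand m y₁ y₂ y₃ y₄ q₁ q₂ q₃ q₄)) Sx≡) ⟩
    m * p - m * c      ≡⟨ solve 3 (λ m p c → m :* p :- m :* c := m :* (p :- c)) refl m p c ⟩
    m * (p - c)        ∎)
    where
    open ≡-Reasoning
    Sy c : ℤ
    Sy = sumSq y₁ y₂ y₃ y₄
    c = + 2 * (q₁ * y₁ + q₂ * y₂ + q₃ * y₃ + q₄ * y₄) + m * sumSq q₁ q₂ q₃ q₄
    expand : ∀ m y₁ y₂ y₃ y₄ q₁ q₂ q₃ q₄ →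
      sumSq (y₁ + q₁ * m) (y₂ + q₂ * m) (y₃ + q₃ * m) (y₄ + q₄ * m) ≡
      sumSq y₁ y₂ y₃ y₄ + m * (+ 2 * (q₁ * y₁ + q₂ * y₂ + q₃ * y₃ + q₄ * y₄) + m * sumSq q₁ q₂ q₃ q₄)
    expand = solve 9 (λ m y₁ y₂ y₃ y₄ q₁ q₂ q₃ q₄ →
      sumSqᴾ (y₁ :+ q₁ :* m) (y₂ :+ q₂ :* m) (y₃ :+ q₃ :* m) (y₄ :+ q₄ :* m) :=
      sumSqᴾ y₁ y₂ y₃ y₄ :+ m :* (con (+ 2) :* (q₁ :* y₁ :+ q₂ :* y₂ :+ q₃ :* y₃ :+ q₄ :* y₄) :+ m :* sumSqᴾ q₁ q₂ q₃ q₄)) refl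

  descent-by-euler : ∀ (m : ℕ) .{{_ : NonZero m}} {R P} y₁ y₂ y₃ y₄ q₁ q₂ q₃ q₄ →
    sumSq y₁ y₂ y₃ y₄ ≡ + m * R →
    sumSq (y₁ + q₁ * + m) (y₂ + q₂ * + m) (y₃ + q₃ * + m) (y₄ + q₄ * + m) ≡ + m * P →
    FourSquares (R * P)
  descent-by-euler m {R} {P} y₁ y₂ y₃ y₄ q₁ q₂ q₃ q₄ Sy≡ Sx≡ =
    fourSquares w₁ w₂ w₃ w₄ (*-cancelˡ-≡ (+ m) _ _ (*-cancelˡ-≡ (+ m) _ _ (begin
        + m * (+ m * sumSq w₁ w₂ w₃ w₄)                       ≡⟨ euler-shifted (+ m) R y₁ y₂ y₃ y₄ q₁ q₂ q₃ q₄ ⟩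
        Sx * Sy + (+ m * R - Sy) * E                          ≡⟨ cong₂ (λ s t → s * t + (+ m * R - t) * E) Sx≡ Sy≡ ⟩
        + m * P * (+ m * R) + (+ m * R - + m * R) * E         ≡⟨ solve 4 (λ m R P E →
                                                                   m :* P :* (m :* R) :+ (m :* R :- m :* R) :* E
                                                                   := m :* (m :* (R :* P))) refl (+ m) R P E ⟩
        + m * (+ m * (R * P))                                 ∎)))
    where
    open ≡-Reasoning
    dot w₁ w₂ w₃ w₄ Sx Sy E : ℤ
    dot = q₁ * y₁ + q₂ * y₂ + q₃ * y₃ + q₄ * y₄
    w₁ = R + dot
    w₂ = q₁ * y₂ - q₂ * y₁ + q₃ * y₄ - q₄ * y₃
    w₃ = q₁ * y₃ - q₃ * y₁ + q₄ * y₂ - q₂ * y₄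
    w₄ = q₁ * y₄ - q₄ * y₁ + q₂ * y₃ - q₃ * y₂
    Sx = sumSq (y₁ + q₁ * + m) (y₂ + q₂ * + m) (y₃ + q₃ * + m) (y₄ + q₄ * + m)
    Sy = sumSq y₁ y₂ y₃ y₄
    E = + m * R + Sy + + 2 * + m * dot
    -- Euler's identity for the product of x = y + q m and y, whose four components are m w₁, …, m w₄
    -- as soon as sumSq y ≡ m R
    euler-shifted : ∀ m R y₁ y₂ y₃ y₄ q₁ q₂ q₃ q₄ →
      m * (m * sumSq (R + (q₁ * y₁ + q₂ * y₂ + q₃ * y₃ + q₄ * y₄)) (q₁ * y₂ - q₂ * y₁ + q₃ * y₄ - q₄ * y₃)
                     (q₁ * y₃ - q₃ * y₁ + q₄ * y₂ - q₂ * y₄) (q₁ * y₄ - q₄ * y₁ + q₂ * y₃ - q₃ * y₂)) ≡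
      sumSq (y₁ + q₁ * m) (y₂ + q₂ * m) (y₃ + q₃ * m) (y₄ + q₄ * m) * sumSq y₁ y₂ y₃ y₄ +
      (m * R - sumSq y₁ y₂ y₃ y₄) * (m * R + sumSq y₁ y₂ y₃ y₄ + + 2 * m * (q₁ * y₁ + q₂ * y₂ + q₃ * y₃ + q₄ * y₄))
    euler-shifted = solve 10 (λ m R y₁ y₂ y₃ y₄ q₁ q₂ q₃ q₄ →
      m :* (m :* sumSqᴾ (R :+ (q₁ :* y₁ :+ q₂ :* y₂ :+ q₃ :* y₃ :+ q₄ :* y₄)) (q₁ :* y₂ :- q₂ :* y₁ :+ q₃ :* y₄ :- q₄ :* y₃)
                        (q₁ :* y₃ :- q₃ :* y₁ :+ q₄ :* y₂ :- q₂ :* y₄) (q₁ :* y₄ :- q₄ :* y₁ :+ q₂ :* y₃ :- q₃ :* y₂)) :=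
      sumSqᴾ (y₁ :+ q₁ :* m) (y₂ :+ q₂ :* m) (y₃ :+ q₃ :* m) (y₄ :+ q₄ :* m) :* sumSqᴾ y₁ y₂ y₃ y₄ :+
      (m :* R :- sumSqᴾ y₁ y₂ y₃ y₄) :* (m :* R :+ sumSqᴾ y₁ y₂ y₃ y₄ :+ con (+ 2) :* m :* (q₁ :* y₁ :+ q₂ :* y₂ :+ q₃ :* y₃ :+ q₄ :* y₄))) refl

  descent-step-centred : ∀ {m p} .{{_ : NonZero m}} → Prime p → 2 ℕ.≤ m → m ℕ.< p →
    ∀ {y₁ y₂ y₃ y₄} q₁ q₂ q₃ q₄ → Centred m y₁ → Centred m y₂ → Centred m y₃ → Centred m y₄ →
    sumSq (y₁ + q₁ * + m) (y₂ + q₂ * + m) (y₃ + q₃ * + m) (y₄ + q₄ * + m) ≡ + m * + p →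
    ∃[ r ] 1 ℕ.≤ r × r ℕ.< m × FourSquares (+ r * + p)
  descent-step-centred {m} {p} p-prime 2≤m m<p {y₁} {y₂} {y₃} {y₄} q₁ q₂ q₃ q₄ c₁ c₂ c₃ c₄ Sx≡ =
    conclude (residues-sumSq-divisible (+ m) (+ p) y₁ y₂ y₃ y₄ q₁ q₂ q₃ q₄ Sx≡)
    where
    m²∤Sx : ∀ {k} → sumSq (y₁ + q₁ * + m) (y₂ + q₂ * + m) (y₃ + q₃ * + m) (y₄ + q₄ * + m) ≡ + m * (+ m * k) → ⊥
    m²∤Sx Sx≡m[mk] = m*p≢m*[m*k] p-prime 2≤m m<p _ (trans (sym Sx≡) Sx≡m[mk])
    conclude : ∃[ R ] sumSq y₁ y₂ y₃ y₄ ≡ + m * R → ∃[ r ] 1 ℕ.≤ r × r ℕ.< m × FourSquares (+ r * + p)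
    conclude (-[1+ _ ] , Sy≡) = ⊥-elim (nonneg≢m*neg (ℕₚ.<⇒≤ 2≤m) (trans (sym (sumSq≡sumSqℕ∣∣ y₁ y₂ y₃ y₄)) Sy≡))
    conclude (+ r , Sy≡) = case residue-trichotomy c₁ c₂ c₃ c₄ (trans Sy≡ (sym (pos-* m r))) of λ where
      (inj₁ (z₁ , z₂ , z₃ , z₄)) → ⊥-elim (m²∤Sx (sumSq-of-multiples (+ m) q₁ q₂ q₃ q₄ z₁ z₂ z₃ z₄))
      (inj₂ (inj₁ (h₁ , h₂ , h₃ , h₄))) → ⊥-elim (m²∤Sx (proj₂ (sumSq-of-odd-multiples-of-half q₁ q₂ q₃ q₄ h₁ h₂ h₃ h₄)))
      (inj₂ (inj₂ (1≤r , r<m))) → r , 1≤r , r<m , descent-by-euler m y₁ y₂ y₃ y₄ q₁ q₂ q₃ q₄ Sy≡ Sx≡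

  descent-step : ∀ {m p} .{{_ : NonZero m}} → Prime p → 2 ℕ.≤ m → m ℕ.< p → FourSquares (+ m * + p) →
                 ∃[ r ] 1 ℕ.≤ r × r ℕ.< m × FourSquares (+ r * + p)
  descent-step {m} p-prime 2≤m m<p (fourSquares x₁ x₂ x₃ x₄ Sx≡) =
    let q₁ , y₁ , x₁≡ , c₁ = centred-residue x₁ m
        q₂ , y₂ , x₂≡ , c₂ = centred-residue x₂ m
        q₃ , y₃ , x₃≡ , c₃ = centred-residue x₃ m
        q₄ , y₄ , x₄≡ , c₄ = centred-residue x₄ m
    in descent-step-centred p-prime 2≤m m<p q₁ q₂ q₃ q₄ c₁ c₂ c₃ c₄
         (trans (sym (sumSq-cong x₁≡ x₂≡ x₃≡ x₄≡)) Sx≡)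

  descent : ∀ {p} → Prime p → ∀ m → 1 ℕ.≤ m → m ℕ.< p → FourSquares (+ m * + p) → FourSquares (+ p)
  descent {p} p-prime = <-rec _ step
    where
    step : ∀ m → (∀ {r} → r ℕ.< m → 1 ℕ.≤ r → r ℕ.< p → FourSquares (+ r * + p) → FourSquares (+ p)) →
           1 ℕ.≤ m → m ℕ.< p → FourSquares (+ m * + p) → FourSquares (+ p)
    step (suc zero) _ _ _ S = subst FourSquares (*-identityˡ (+ p)) S
    step m@(suc (suc _)) rec _ m<p S = case descent-step p-prime (s≤s (s≤s z≤n)) m<p S of λ where
      (r , 1≤r , r<m , S′) → rec r<m 1≤r (ℕₚ.<-trans r<m m<p) S′

  oddPrime-fourSquares : ∀ {h} → Prime (suc (h ℕ.+ h)) → FourSquares (+ suc (h ℕ.+ h))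
  oddPrime-fourSquares {zero} p-prime = ⊥-elim (¬prime[1] p-prime)
  oddPrime-fourSquares {h@(suc _)} p-prime = from-multiple (x²+y²+1-divisible p-prime)
    where
    p′ : ℕ
    p′ = suc (h ℕ.+ h)
    from-multiple : (∃₂ λ x l → x ℕ.≤ h × l ℕ.≤ h × p′ ∣ x ℕ.* x ℕ.+ suc (l ℕ.* l)) → FourSquares (+ p′)
    from-multiple (x , l , x≤h , l≤h , divides k x²+l²+1≡kp′) =
      descent p-prime k 1≤k k<p′ (fourSquares (+ x) (+ l) 1ℤ 0ℤ sumSq≡kp′)
      where
      identity : ∀ x l → x ℕ.* x ℕ.+ l ℕ.* l ℕ.+ 1 ℕ.* 1 ℕ.+ 0 ℕ.* 0 ≡ x ℕ.* x ℕ.+ suc (l ℕ.* l)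
      identity = ℕ-solve-∀
      sumSq≡kp′ : sumSq (+ x) (+ l) 1ℤ 0ℤ ≡ + k * + p′
      sumSq≡kp′ = begin
        sumSq (+ x) (+ l) 1ℤ 0ℤ  ≡⟨ sumSq≡sumSqℕ∣∣ (+ x) (+ l) 1ℤ 0ℤ ⟩
        + sumSqℕ x l 1 0         ≡⟨ cong +_ (trans (identity x l) x²+l²+1≡kp′) ⟩
        + (k ℕ.* p′)             ≡⟨ pos-* k p′ ⟩
        + k * + p′               ∎
        where open ≡-Reasoning
      1≤k : 1 ℕ.≤ k
      1≤k = ℕₚ.n≢0⇒n>0 λ { refl → ℕₚ.1+n≢0 (ℕₚ.m+n≡0⇒n≡0 (x ℕ.* x) x²+l²+1≡kp′) }
      k<p′ : k ℕ.< p′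
      k<p′ = ℕₚ.*-cancelʳ-< p′ k p′ (begin-strict
        k ℕ.* p′                                              ≡⟨ sym x²+l²+1≡kp′ ⟩
        x ℕ.* x ℕ.+ suc (l ℕ.* l)                             ≤⟨ ℕₚ.+-mono-≤ (square-mono-≤ x≤h) (s≤s (square-mono-≤ l≤h)) ⟩
        h ℕ.* h ℕ.+ suc (h ℕ.* h)                             <⟨ ℕₚ.m<m+n _ ℕ.z<s ⟩
        h ℕ.* h ℕ.+ suc (h ℕ.* h) ℕ.+ (h ℕ.+ h) ℕ.* (h ℕ.+ 2) ≡⟨ expand h ⟩
        p′ ℕ.* p′                                             ∎)
        where
        open ℕₚ.≤-Reasoning
        expand : ∀ h → h ℕ.* h ℕ.+ suc (h ℕ.* h) ℕ.+ (h ℕ.+ h) ℕ.* (h ℕ.+ 2) ≡ suc (h ℕ.+ h) ℕ.* suc (h ℕ.+ h)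
        expand = ℕ-solve-∀

  even⊎odd : ∀ n → (∃[ h ] n ≡ h ℕ.+ h) ⊎ (∃[ h ] n ≡ suc (h ℕ.+ h))
  even⊎odd zero = inj₁ (0 , refl)
  even⊎odd (suc n) with even⊎odd n
  ... | inj₁ (h , refl) = inj₂ (h , refl)
  ... | inj₂ (h , refl) = inj₁ (suc h , cong suc (sym (ℕₚ.+-suc h h)))

  prime-fourSquares : ∀ {p} → Prime p → FourSquares (+ p)
  prime-fourSquares {p} p-prime with even⊎odd p
  ... | inj₂ (h , refl) = oddPrime-fourSquares {h} p-prime
  ... | inj₁ (h , refl) with prime⇒irreducible p-prime (divides h (sym (trans (ℕₚ.*-comm h 2) (cong (h ℕ.+_) (ℕₚ.+-identityʳ h)))))
  ...   | inj₁ ()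
  ...   | inj₂ 2≡h+h = subst (λ n → FourSquares (+ n)) 2≡h+h (fourSquares 1ℤ 1ℤ 0ℤ 0ℤ refl)

  natural-fourSquares : ∀ n → FourSquares (+ n)
  natural-fourSquares zero = fourSquares 0ℤ 0ℤ 0ℤ 0ℤ refl
  natural-fourSquares n@(suc _) = subst (λ n → FourSquares (+ n)) (sym (isFactorisation (factorise n)))
                                    (primes-fourSquares (factorsPrime (factorise n)))
    where
    primes-fourSquares : ∀ {ps} → All Prime ps → FourSquares (+ product ps)
    primes-fourSquares [] = fourSquares 1ℤ 0ℤ 0ℤ 0ℤ refl
    primes-fourSquares {p ∷ ps} (p-prime ∷ ps-prime) =
      subst FourSquares (sym (pos-* p (product ps))) (fourSquares-* (prime-fourSquares p-prime) (primes-fourSquares ps-prime))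

  lagrange-four-squares : ∀ n → ∃[ a ] ∃[ b ] ∃[ c ] ∃[ d ] sumSqℕ a b c d ≡ n
  lagrange-four-squares n with fourSquares a b c d S≡n ← natural-fourSquares n =
    ∣ a ∣ , ∣ b ∣ , ∣ c ∣ , ∣ d ∣ , +-injective (trans (sym (sumSq≡sumSqℕ∣∣ a b c d)) S≡n)

open FourSquareTheorem using (sumSqℕ; lagrange-four-squares)

open import Data.Nat.Base
open import Data.Nat.Properties
open import Data.Nat.ListAction using (sum)
open import Data.Nat.ListAction.Properties using (sum-++; sum-↭)
open import Data.Nat.Tactic.RingSolver using (solve-∀)
open import Data.Bool.Base using (if_then_else_)
open import Data.Empty using (⊥-elim)
open import Data.Product using (_,_; _×_; proj₁; proj₂; ∃-syntax)
open import Data.Sum using (inj₁; inj₂)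
open import Data.List.Base using (List; []; _∷_; _++_; map; filter; length; replicate)
open import Data.List.Properties
  using (filter-++; filter-accept; filter-reject; filter-none; length-filter; length-++; length-++-sucʳ; length-map;
         length-replicate; map-++)
open import Data.List.Membership.Propositional using (_∈_)
open import Data.List.Membership.Propositional.Properties using (∈-∃++; ∈-++⁻; ∈-++⁺ˡ; ∈-++⁺ʳ; ∈-map⁺; ∈-filter⁺)
open import Data.List.Relation.Binary.Subset.Propositional using (_⊆_)
open import Data.List.Relation.Binary.Permutation.Propositional using (_↭_; ↭-sym)
open import Data.List.Relation.Binary.Permutation.Propositional.Properties using (↭-length; All-resp-↭)
import Data.List.Relation.Binary.Permutation.Propositional.Properties as ↭
open import Data.List.Relation.Unary.Any using (here; there)
open import Data.List.Relation.Unary.All as All using (All; []; _∷_)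
import Data.List.Relation.Unary.All.Properties as All
open import Data.List.Relation.Unary.All.Properties using (all-filter)
import Data.List.Relation.Unary.AllPairs as AllPairs
open AllPairs using ([]; _∷_)
import Data.List.Relation.Unary.AllPairs.Properties as AllPairs
open import Data.List.Relation.Unary.Linked using (Linked; _∷_; [-])
open import Data.List.Relation.Unary.Unique.Propositional using (Unique)
open import Data.List.Relation.Unary.Unique.DecPropositional _≟_ using (unique?)
open import Relation.Binary.Properties.DecTotalOrder ≤-decTotalOrder using (≥-decTotalOrder)
open import Data.List.Sort ≥-decTotalOrder using (sort; sort-↭; sort-↗)
open import Function.Base using (_∘_; id)
open import Relation.Nullary using (does; yes; no; ¬_)
open import Relation.Nullary.Decidable using (dec-true; dec-false; from-yes; ¬?; _×-dec_; _→-dec_)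
open import Relation.Binary.PropositionalEquality

-- Counting partitions by their largest part

count : ℕ → ℕ → List (List ℕ) → ℕ
count k n xss = length (filter (λ xs → powSum k xs ≟ n) xss)

count-++ : ∀ k n xss yss → count k n (xss ++ yss) ≡ count k n xss + count k n yss
count-++ k n xss yss = trans (cong length (filter-++ _ xss yss)) (length-++ (filter _ xss))

count-∷-≡ : ∀ k n xs xss → powSum k xs ≡ n → count k n (xs ∷ xss) ≡ suc (count k n xss)
count-∷-≡ k n xs xss xs↦n = cong length (filter-accept (λ ys → powSum k ys ≟ n) {xs} {xss} xs↦n)

count-∷-≢ : ∀ k n xs xss → powSum k xs ≢ n → count k n (xs ∷ xss) ≡ count k n xss
count-∷-≢ k n xs xss xs↛n = cong length (filter-reject (λ ys → powSum k ys ≟ n) {xs} {xss} xs↛n)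

count-map-∷ : ∀ k x n xss → count k (x ^ k + n) (map (x ∷_) xss) ≡ count k n xss
count-map-∷ k x n [] = refl
count-map-∷ k x n (xs ∷ xss) with powSum k xs ≟ n
... | yes xs↦n = begin
  count k (x ^ k + n) (map (x ∷_) (xs ∷ xss)) ≡⟨ count-∷-≡ k (x ^ k + n) (x ∷ xs) (map (x ∷_) xss) (cong (x ^ k +_) xs↦n) ⟩
  suc (count k (x ^ k + n) (map (x ∷_) xss))  ≡⟨ cong suc (count-map-∷ k x n xss) ⟩
  suc (count k n xss)                         ≡⟨ count-∷-≡ k n xs xss xs↦n ⟨
  count k n (xs ∷ xss)                        ∎
  where open ≡-Reasoning
... | no xs↛n = begin
  count k (x ^ k + n) (map (x ∷_) (xs ∷ xss))
    ≡⟨ count-∷-≢ k (x ^ k + n) (x ∷ xs) (map (x ∷_) xss) (xs↛n ∘ +-cancelˡ-≡ (x ^ k) _ _) ⟩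
  count k (x ^ k + n) (map (x ∷_) xss)        ≡⟨ count-map-∷ k x n xss ⟩
  count k n xss                               ≡⟨ count-∷-≢ k n xs xss xs↛n ⟨
  count k n (xs ∷ xss)                        ∎
  where open ≡-Reasoning

count-map-∷-≤ : ∀ k x n xss → x ^ k ≤ n → count k n (map (x ∷_) xss) ≡ count k (n ∸ x ^ k) xss
count-map-∷-≤ k x n xss x^k≤n =
  trans (cong (λ n → count k n (map (x ∷_) xss)) (sym (m+[n∸m]≡n x^k≤n))) (count-map-∷ k x (n ∸ x ^ k) xss)

count-map-∷-> : ∀ k x n xss → n < x ^ k → count k n (map (x ∷_) xss) ≡ 0
count-map-∷-> k x n xss n<x^k = cong length (filter-none (λ ys → powSum k ys ≟ n)
  (All.map⁺ (All.universal (λ xs x^k+xs≡n → <⇒≱ n<x^k (≤-trans (m≤m+n (x ^ k) _) (≤-reflexive x^k+xs≡n))) xss)))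

-- The partitions of n into j positive k-th powers ≤ b + 1, split by whether b + 1 occurs.
p≤ : ℕ → ℕ → ℕ → ℕ → ℕ
p≤ k n       (suc j) zero    = 0
p≤ k zero    zero    b       = 1
p≤ k (suc n) zero    b       = 0
p≤ k n       (suc j) (suc b) =
  p≤ k n (suc j) b + (if does (suc b ^ k ≤? n) then p≤ k (n ∸ suc b ^ k) j (suc b) else 0)

p≤-step-≤ : ∀ k n j b → suc b ^ k ≤ n → p≤ k n (suc j) (suc b) ≡ p≤ k n (suc j) b + p≤ k (n ∸ suc b ^ k) j (suc b)
p≤-step-≤ k n j b s≤n =
  cong (λ c → p≤ k n (suc j) b + (if c then p≤ k (n ∸ suc b ^ k) j (suc b) else 0)) (dec-true (suc b ^ k ≤? n) s≤n)

p≤-step-≰ : ∀ k n j b → ¬ suc b ^ k ≤ n → p≤ k n (suc j) (suc b) ≡ p≤ k n (suc j) b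
p≤-step-≰ k n j b s≰n = trans
  (cong (λ c → p≤ k n (suc j) b + (if c then p≤ k (n ∸ suc b ^ k) j (suc b) else 0)) (dec-false (suc b ^ k ≤? n) s≰n))
  (+-identityʳ _)

count≡p≤ : ∀ k n j b → count k n (nonincLists j b) ≡ p≤ k n j b
count≡p≤ k n       (suc j) zero    = refl
count≡p≤ k n       (suc j) (suc b) with suc b ^ k ≤? n
... | yes s≤n = begin
  count k n (nonincLists (suc j) b ++ map (suc b ∷_) L)           ≡⟨ count-++ k n (nonincLists (suc j) b) _ ⟩
  count k n (nonincLists (suc j) b) + count k n (map (suc b ∷_) L) ≡⟨ cong₂ _+_ (count≡p≤ k n (suc j) b)
                                                                        (trans (count-map-∷-≤ k (suc b) n L s≤n)
                                                                               (count≡p≤ k (n ∸ suc b ^ k) j (suc b))) ⟩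
  p≤ k n (suc j) b + p≤ k (n ∸ suc b ^ k) j (suc b)               ≡⟨ p≤-step-≤ k n j b s≤n ⟨
  p≤ k n (suc j) (suc b)                                           ∎
  where
  open ≡-Reasoning
  L : List (List ℕ)
  L = nonincLists j (suc b)
... | no s≰n = begin
  count k n (nonincLists (suc j) b ++ map (suc b ∷_) L)           ≡⟨ count-++ k n (nonincLists (suc j) b) _ ⟩
  count k n (nonincLists (suc j) b) + count k n (map (suc b ∷_) L) ≡⟨ cong₂ _+_ (count≡p≤ k n (suc j) b)
                                                                        (count-map-∷-> k (suc b) n L (≰⇒> s≰n)) ⟩
  p≤ k n (suc j) b + 0                                             ≡⟨ +-identityʳ _ ⟩
  p≤ k n (suc j) b                                                 ≡⟨ p≤-step-≰ k n j b s≰n ⟨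
  p≤ k n (suc j) (suc b)                                           ∎
  where
  open ≡-Reasoning
  L : List (List ℕ)
  L = nonincLists j (suc b)
count≡p≤ k zero    zero    b       = refl
count≡p≤ k (suc n) zero    b       = refl

p≡p≤ : ∀ k n j → p k n j ≡ p≤ k n j n
p≡p≤ k n j = count≡p≤ k n j n

∸-<-+ : ∀ {n s j} → s ≤ n → n < s + j → n ∸ s < j
∸-<-+ {n} {s} {j} s≤n n<s+j = +-cancelˡ-< s (n ∸ s) j (subst (_< s + j) (sym (m+[n∸m]≡n s≤n)) n<s+j)

mutual
  p≤≡0 : ∀ k {n j} b → n < j → p≤ k n j b ≡ 0
  p≤≡0 k {j = suc j} zero    _     = refl
  p≤≡0 k {j = suc j} (suc b) n<1+j =
    trans (p≤-suc-unattainable k b (≤-trans n<1+j (+-monoˡ-≤ j (m^n>0 (suc b) k)))) (p≤≡0 k b n<1+j)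

  p≤-suc-unattainable : ∀ k {n j} b → n < suc b ^ k + j → p≤ k n (suc j) (suc b) ≡ p≤ k n (suc j) b
  p≤-suc-unattainable k {n} {j} b n<s+j with suc b ^ k ≤? n
  ... | yes s≤n = trans (p≤-step-≤ k n j b s≤n)
                        (trans (cong (p≤ k n (suc j) b +_) (p≤≡0 k (suc b) (∸-<-+ s≤n n<s+j))) (+-identityʳ _))
  ... | no s≰n = p≤-step-≰ k n j b s≰n

p≤-+-unattainable : ∀ k {n j} b c → n < suc b ^ k + j → p≤ k n (suc j) (c + b) ≡ p≤ k n (suc j) b
p≤-+-unattainable k b zero    _      = refl
p≤-+-unattainable k {j = j} b (suc c) n<s+j =
  trans (p≤-suc-unattainable k (c + b) (≤-trans n<s+j (+-monoˡ-≤ j (^-monoˡ-≤ k (s≤s (m≤n+m b c))))))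
        (p≤-+-unattainable k b c n<s+j)

-- Excess at most 42

2-squared≤ : ∀ b → 4 ≤ suc (suc b) ^ 2
2-squared≤ b = ^-monoˡ-≤ 2 (s≤s (s≤s (z≤n {b})))

p≤-no-parts : ∀ k n b b′ → p≤ k n 0 b ≡ p≤ k n 0 b′
p≤-no-parts k zero    b b′ = refl
p≤-no-parts k (suc n) b b′ = refl

-- Every part x ≥ 2 adds x² - 1 ≥ 3 to the excess m, so for m < 3 (j + 1) some part is 1,
-- and deleting it is a bijection onto the partitions of j + m into j squares.
p≤-drop-one : ∀ b j m → m < 3 * suc j → p≤ 2 (suc j + m) (suc j) (suc b) ≡ p≤ 2 (j + m) j (suc b)
p≤-drop-one zero    j       m _   = refl
p≤-drop-one (suc b) zero    m m<3 = begin
  p≤ 2 (suc m) 1 (2 + b) ≡⟨ p≤-suc-unattainable 2 (suc b) 1+m<s+0 ⟩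
  p≤ 2 (suc m) 1 (1 + b) ≡⟨ p≤-drop-one b zero m m<3 ⟩
  p≤ 2 m 0 (1 + b)       ≡⟨ p≤-no-parts 2 m (1 + b) (2 + b) ⟩
  p≤ 2 m 0 (2 + b)       ∎
  where
  open ≡-Reasoning
  1+m<s+0 : suc m < suc (suc b) ^ 2 + 0
  1+m<s+0 = ≤-trans (s≤s m<3) (≤-trans (2-squared≤ b) (m≤m+n _ 0))
p≤-drop-one (suc b) (suc j) m m<3[2+j] with suc (suc b) ^ 2 ≤? suc m
... | yes s≤1+m = begin
  p≤ 2 (2 + j + m) (2 + j) (2 + b)
    ≡⟨ p≤-step-≤ 2 (2 + j + m) (suc j) (suc b) (s≤i+1+m (suc j)) ⟩
  p≤ 2 (2 + j + m) (2 + j) (1 + b) + p≤ 2 (2 + j + m ∸ s) (1 + j) (2 + b)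
    ≡⟨ cong₂ _+_ (p≤-drop-one b (suc j) m m<3[2+j]) (begin
         p≤ 2 (2 + j + m ∸ s) (1 + j) (2 + b)  ≡⟨ cong (λ n → p≤ 2 n (1 + j) (2 + b)) (∸-+-shift (suc j)) ⟩
         p≤ 2 (suc j + m′) (1 + j) (2 + b)     ≡⟨ p≤-drop-one (suc b) j m′ m′<3[1+j] ⟩
         p≤ 2 (j + m′) j (2 + b)               ≡⟨ cong (λ n → p≤ 2 n j (2 + b)) (∸-+-shift j) ⟨
         p≤ 2 (1 + j + m ∸ s) j (2 + b)        ∎) ⟩
  p≤ 2 (1 + j + m) (1 + j) (1 + b) + p≤ 2 (1 + j + m ∸ s) j (2 + b)
    ≡⟨ p≤-step-≤ 2 (1 + j + m) j (suc b) (s≤i+1+m j) ⟨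
  p≤ 2 (1 + j + m) (1 + j) (2 + b) ∎
  where
  open ≡-Reasoning
  s m′ : ℕ
  s = suc (suc b) ^ 2
  m′ = suc m ∸ s
  s≤i+1+m : ∀ i → s ≤ suc i + m
  s≤i+1+m i = ≤-trans s≤1+m (≤-trans (m≤n+m (suc m) i) (≤-reflexive (+-suc i m)))
  ∸-+-shift : ∀ i → suc i + m ∸ s ≡ i + m′
  ∸-+-shift i = trans (cong (_∸ s) (sym (+-suc i m))) (+-∸-assoc i s≤1+m)
  m′<3[1+j] : m′ < 3 * suc j
  m′<3[1+j] = ≤-<-trans (∸-monoʳ-≤ (suc m) (2-squared≤ b)) (m<n+o⇒m∸n<o m 3 (subst (m <_) (*-suc 3 (suc j)) m<3[2+j]))
... | no s≰1+m = begin
  p≤ 2 (2 + j + m) (2 + j) (2 + b) ≡⟨ p≤-suc-unattainable 2 (suc b) (i+1+m<s+i (suc j)) ⟩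
  p≤ 2 (2 + j + m) (2 + j) (1 + b) ≡⟨ p≤-drop-one b (suc j) m m<3[2+j] ⟩
  p≤ 2 (1 + j + m) (1 + j) (1 + b) ≡⟨ p≤-suc-unattainable 2 (suc b) (i+1+m<s+i j) ⟨
  p≤ 2 (1 + j + m) (1 + j) (2 + b) ∎
  where
  open ≡-Reasoning
  i+1+m<s+i : ∀ i → suc i + m < suc (suc b) ^ 2 + i
  i+1+m<s+i i = subst₂ _<_ (+-suc i m) (+-comm i _) (+-monoʳ-< i (≰⇒> s≰1+m))

p≤-drop-ones : ∀ b i j m → m < 3 * suc j → p≤ 2 (i + j + m) (i + j) (suc b) ≡ p≤ 2 (j + m) j (suc b)
p≤-drop-ones b zero    j m _      = refl
p≤-drop-ones b (suc i) j m m<3[1+j] =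
  trans (p≤-drop-one b (i + j) m (<-≤-trans m<3[1+j] (*-monoʳ-≤ 3 (s≤s (m≤n+m j i)))))
        (p≤-drop-ones b i j m m<3[1+j])

small-excess-table : ∀ {j} → j < 15 → 10 ≤ j → ∀ {m} → m < 43 → p≤ 2 (j + m) j 6 ≢ 3
small-excess-table = from-yes (allUpTo? (λ j → 10 ≤? j →-dec allUpTo? (λ m → ¬? (p≤ 2 (j + m) j 6 ≟ 3)) 43) 15)

p≤-small-excess : ∀ {j m} → 10 ≤ j → m ≤ 42 → p≤ 2 (j + m) j 6 ≢ 3
p≤-small-excess {j} {m} 10≤j m≤42 with j <? 15
... | yes j<15 = small-excess-table j<15 10≤j (s≤s m≤42)
... | no j≮15 = subst (λ j → p≤ 2 (j + m) j 6 ≢ 3) (m∸n+n≡m 14≤j) λ p≤≡3 →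
  small-excess-table ≤-refl (+-monoʳ-≤ 10 z≤n) (s≤s m≤42)
    (trans (sym (p≤-drop-ones 5 (j ∸ 14) 14 m (s≤s (≤-trans m≤42 (m≤m+n 42 _))))) p≤≡3)
  where
  14≤j : 14 ≤ j
  14≤j = ≤-trans (n≤1+n 14) (≮⇒≥ j≮15)

p-small-excess : ∀ {j m} → 10 ≤ j → m ≤ 42 → p 2 (j + m) j ≢ 3
p-small-excess {suc j} {m} 10≤j m≤42 = p≤-small-excess 10≤j m≤42 ∘ trans (sym parts≤6)
  where
  n : ℕ
  n = suc j + m
  6≤n : 6 ≤ n
  6≤n = ≤-trans (≤-trans (+-monoʳ-≤ 6 z≤n) 10≤j) (m≤m+n (suc j) m)
  n<7²+j : n < 7 ^ 2 + j
  n<7²+j = subst (λ x → suc x ≤ 49 + j) (cong suc (+-comm m j)) (+-monoˡ-≤ j (s≤s (s≤s (≤-trans m≤42 (m≤m+n 42 5)))))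
  parts≤6 : p 2 n (suc j) ≡ p≤ 2 n (suc j) 6
  parts≤6 = begin
    p 2 n (suc j)               ≡⟨ p≡p≤ 2 n (suc j) ⟩
    p≤ 2 n (suc j) n            ≡⟨ cong (p≤ 2 n (suc j)) (m∸n+n≡m 6≤n) ⟨
    p≤ 2 n (suc j) (n ∸ 6 + 6)  ≡⟨ p≤-+-unattainable 2 6 (n ∸ 6) n<7²+j ⟩
    p≤ 2 n (suc j) 6            ∎
    where open ≡-Reasoning

-- Excess at least 43

⊆-Unique⇒length≤ : ∀ {A : Set} {xs ys : List A} → Unique xs → xs ⊆ ys → length xs ≤ length ys
⊆-Unique⇒length≤ [] _ = z≤n
⊆-Unique⇒length≤ {xs = x ∷ xs} (x∉xs ∷ xs-unique) x∷xs⊆ys with as , bs , refl ← ∈-∃++ (x∷xs⊆ys (here refl)) =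
  ≤-trans (s≤s (⊆-Unique⇒length≤ xs-unique xs⊆as++bs)) (≤-reflexive (sym (length-++-sucʳ as x bs)))
  where
  xs⊆as++bs : xs ⊆ as ++ bs
  xs⊆as++bs {z} z∈xs with ∈-++⁻ as (x∷xs⊆ys (there z∈xs))
  ... | inj₁ z∈as = ∈-++⁺ˡ z∈as
  ... | inj₂ (here z≡x) = ⊥-elim (All.lookup x∉xs z∈xs (sym z≡x))
  ... | inj₂ (there z∈bs) = ∈-++⁺ʳ as z∈bs

Unique-map-reflect : ∀ {A B C : Set} {f : A → B} {g : A → C} {xs} →
  (∀ {x y} → f x ≡ f y → g x ≡ g y) → Unique (map g xs) → Unique (map f xs)
Unique-map-reflect g-respects = AllPairs.map⁺ ∘ AllPairs.map (_∘ g-respects) ∘ AllPairs.map⁻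

nonincLists-mono : ∀ j {c b} → c ≤′ b → nonincLists j c ⊆ nonincLists j b
nonincLists-mono j       ≤′-refl          = id
nonincLists-mono zero    (≤′-step c≤′b) = nonincLists-mono zero c≤′b
nonincLists-mono (suc j) (≤′-step c≤′b) = ∈-++⁺ˡ ∘ nonincLists-mono (suc j) c≤′b

∈-nonincLists : ∀ {b} xs → Linked _≥_ (b ∷ xs) → All (1 ≤_) xs → xs ∈ nonincLists (length xs) b
∈-nonincLists []             _              _             = here refl
∈-nonincLists (suc x ∷ xs) (1+x≤b ∷ x≥xs) (_ ∷ xs-pos) =
  nonincLists-mono (suc (length xs)) (≤⇒≤′ 1+x≤b)
    (∈-++⁺ʳ (nonincLists (suc (length xs)) x) (∈-map⁺ (suc x ∷_) (∈-nonincLists xs x≥xs xs-pos)))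

sort-∈-nonincLists : ∀ {b} xs → All (λ x → 1 ≤ x × x ≤ b) xs → sort xs ∈ nonincLists (length xs) b
sort-∈-nonincLists {b} xs bounds =
  subst (λ j → sort xs ∈ nonincLists j b) (↭-length (sort-↭ xs))
    (∈-nonincLists (sort xs) (below-b (sort-↗ xs) (All.map proj₂ sorted-bounds)) (All.map proj₁ sorted-bounds))
  where
  sorted-bounds : All (λ x → 1 ≤ x × x ≤ b) (sort xs)
  sorted-bounds = All-resp-↭ (↭-sym (sort-↭ xs)) bounds
  below-b : ∀ {ys} → Linked _≥_ ys → All (_≤ b) ys → Linked _≥_ (b ∷ ys)
  below-b {[]}    _      _         = [-]
  below-b {_ ∷ _} sorted (y≤b ∷ _) = y≤b ∷ sorted

powSum-++ : ∀ k xs ys → powSum k (xs ++ ys) ≡ powSum k xs + powSum k ys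
powSum-++ k xs ys = trans (cong sum (map-++ (_^ k) xs ys)) (sum-++ (map (_^ k) xs) _)

powSum-↭ : ∀ k {xs ys} → xs ↭ ys → powSum k xs ≡ powSum k ys
powSum-↭ k xs↭ys = sum-↭ (↭.map⁺ (_^ k) xs↭ys)

powSum-ones : ∀ k r → powSum k (replicate r 1) ≡ r
powSum-ones k zero    = refl
powSum-ones k (suc r) = cong₂ _+_ (^-zeroˡ k) (powSum-ones k r)

All-≤-powSum : ∀ k xs → All (_≤ powSum (suc k) xs) xs
All-≤-powSum k [] = []
All-≤-powSum k (x ∷ xs) =
  ≤-trans (≤-pow x) (m≤m+n _ _) ∷ All.map (λ y≤ → ≤-trans y≤ (m≤n+m _ (x ^ suc k))) (All-≤-powSum k xs)
  where
  ≤-pow : ∀ x → x ≤ x ^ suc k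
  ≤-pow zero    = z≤n
  ≤-pow (suc x) = ≤-trans (≤-reflexive (sym (^-identityʳ (suc x)))) (^-monoʳ-≤ (suc x) (s≤s (z≤n {k})))

powSum-positive : ∀ k xs → powSum (suc k) (filter (1 ≤?_) xs) ≡ powSum (suc k) xs
powSum-positive k []           = refl
powSum-positive k (zero ∷ xs)  = powSum-positive k xs
powSum-positive k (suc x ∷ xs) = cong (suc x ^ suc k +_) (powSum-positive k xs)

sum-of-four-positive-squares : ∀ n → ∃[ xs ] length xs ≤ 4 × All (1 ≤_) xs × powSum 2 xs ≡ n
sum-of-four-positive-squares n = drop-zeros (lagrange-four-squares n)
  where
  identity : ∀ a b c d → a * (a * 1) + (b * (b * 1) + (c * (c * 1) + (d * (d * 1) + 0))) ≡ a * a + b * b + c * c + d * d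
  identity = solve-∀
  drop-zeros : ∃[ a ] ∃[ b ] ∃[ c ] ∃[ d ] sumSqℕ a b c d ≡ n → ∃[ xs ] length xs ≤ 4 × All (1 ≤_) xs × powSum 2 xs ≡ n
  drop-zeros (a , b , c , d , a²+b²+c²+d²≡n) =
    filter (1 ≤?_) abcd , length-filter (1 ≤?_) abcd , all-filter (1 ≤?_) abcd ,
    trans (powSum-positive 1 abcd) (trans (identity a b c d) a²+b²+c²+d²≡n)
    where
    abcd : List ℕ
    abcd = a ∷ b ∷ c ∷ d ∷ []

-- For each k ≤ 4, four multisets of 10 - k positive integers whose squares sum to 53 = 43 + 10,
-- told apart by their sums of fourth powers.
fillers : ℕ → List (List ℕ)
fillers 0 = (6 ∷ 3 ∷ 1 ∷ 1 ∷ 1 ∷ 1 ∷ 1 ∷ 1 ∷ 1 ∷ 1 ∷ [])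
          ∷ (5 ∷ 3 ∷ 3 ∷ 2 ∷ 1 ∷ 1 ∷ 1 ∷ 1 ∷ 1 ∷ 1 ∷ [])
          ∷ (4 ∷ 3 ∷ 3 ∷ 2 ∷ 2 ∷ 2 ∷ 2 ∷ 1 ∷ 1 ∷ 1 ∷ [])
          ∷ (3 ∷ 3 ∷ 3 ∷ 3 ∷ 3 ∷ 2 ∷ 1 ∷ 1 ∷ 1 ∷ 1 ∷ []) ∷ []
fillers 1 = (6 ∷ 2 ∷ 2 ∷ 2 ∷ 1 ∷ 1 ∷ 1 ∷ 1 ∷ 1 ∷ [])
          ∷ (5 ∷ 3 ∷ 2 ∷ 2 ∷ 2 ∷ 2 ∷ 1 ∷ 1 ∷ 1 ∷ [])
          ∷ (4 ∷ 4 ∷ 3 ∷ 2 ∷ 2 ∷ 1 ∷ 1 ∷ 1 ∷ 1 ∷ [])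
          ∷ (4 ∷ 3 ∷ 2 ∷ 2 ∷ 2 ∷ 2 ∷ 2 ∷ 2 ∷ 2 ∷ []) ∷ []
fillers 2 = (5 ∷ 4 ∷ 2 ∷ 2 ∷ 1 ∷ 1 ∷ 1 ∷ 1 ∷ [])
          ∷ (5 ∷ 2 ∷ 2 ∷ 2 ∷ 2 ∷ 2 ∷ 2 ∷ 2 ∷ [])
          ∷ (4 ∷ 4 ∷ 4 ∷ 1 ∷ 1 ∷ 1 ∷ 1 ∷ 1 ∷ [])
          ∷ (4 ∷ 4 ∷ 2 ∷ 2 ∷ 2 ∷ 2 ∷ 2 ∷ 1 ∷ []) ∷ []
fillers 3 = (6 ∷ 3 ∷ 2 ∷ 1 ∷ 1 ∷ 1 ∷ 1 ∷ [])
          ∷ (5 ∷ 3 ∷ 3 ∷ 2 ∷ 2 ∷ 1 ∷ 1 ∷ [])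
          ∷ (4 ∷ 4 ∷ 3 ∷ 3 ∷ 1 ∷ 1 ∷ 1 ∷ [])
          ∷ (3 ∷ 3 ∷ 3 ∷ 3 ∷ 3 ∷ 2 ∷ 2 ∷ []) ∷ []
fillers _ = (6 ∷ 2 ∷ 2 ∷ 2 ∷ 2 ∷ 1 ∷ [])
          ∷ (5 ∷ 4 ∷ 3 ∷ 1 ∷ 1 ∷ 1 ∷ [])
          ∷ (4 ∷ 4 ∷ 3 ∷ 2 ∷ 2 ∷ 2 ∷ [])
          ∷ (4 ∷ 3 ∷ 3 ∷ 3 ∷ 3 ∷ 1 ∷ []) ∷ []

Filler : ℕ → List ℕ → Set
Filler k f = length f + k ≡ 10 × All (1 ≤_) f × powSum 2 f ≡ 53

fillers-valid : ∀ {k} → k < 5 →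
  length (fillers k) ≡ 4 × All (Filler k) (fillers k) × Unique (map (powSum 4) (fillers k))
fillers-valid = from-yes (allUpTo? (λ k →
  length (fillers k) ≟ 4 ×-dec
  All.all? (λ f → length f + k ≟ 10 ×-dec All.all? (1 ≤?_) f ×-dec powSum 2 f ≟ 53) (fillers k) ×-dec
  unique? (map (powSum 4) (fillers k))) 5)

distinct-representations≤p : ∀ {k n j yss} → Unique yss → All (λ ys → ys ∈ nonincLists j n × powSum k ys ≡ n) yss →
                              length yss ≤ p k n j
distinct-representations≤p {k} {n} unique representations =
  ⊆-Unique⇒length≤ unique λ ys∈yss → let ys∈L , ys↦n = All.lookup representations ys∈yss
                                      in ∈-filter⁺ (λ ys → powSum k ys ≟ n) ys∈L ys↦n

module _ {j′ m′ : ℕ} {xs : List ℕ} (xs-pos : All (1 ≤_) xs) (xs↦m′ : powSum 2 xs ≡ m′) where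

  base : List ℕ → List ℕ
  base f = replicate j′ 1 ++ xs ++ f

  representation : List ℕ → List ℕ
  representation f = sort (base f)

  base-powSum : ∀ k f → powSum k (base f) ≡ j′ + powSum k xs + powSum k f
  base-powSum k f = begin
    powSum k (replicate j′ 1 ++ xs ++ f)           ≡⟨ powSum-++ k (replicate j′ 1) _ ⟩
    powSum k (replicate j′ 1) + powSum k (xs ++ f) ≡⟨ cong₂ _+_ (powSum-ones k j′) (powSum-++ k xs f) ⟩
    j′ + (powSum k xs + powSum k f)                ≡⟨ +-assoc j′ _ _ ⟨
    j′ + powSum k xs + powSum k f                  ∎
    where open ≡-Reasoning

  representation-powSum : ∀ k f → powSum k (representation f) ≡ j′ + powSum k xs + powSum k f
  representation-powSum k f = trans (powSum-↭ k (sort-↭ (base f))) (base-powSum k f)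

  representation-valid : ∀ {f} → Filler (length xs) f →
    representation f ∈ nonincLists (10 + j′) (10 + j′ + (43 + m′)) × powSum 2 (representation f) ≡ 10 + j′ + (43 + m′)
  representation-valid {f} (|f|+k≡10 , f-pos , f↦53) =
    subst (λ j → representation f ∈ nonincLists j _) |ys|≡10+j′ (sort-∈-nonincLists ys bounds) ,
    trans (powSum-↭ 2 (sort-↭ ys)) ys↦n
    where
    ys : List ℕ
    ys = base f
    ys↦n : powSum 2 ys ≡ 10 + j′ + (43 + m′)
    ys↦n = trans (base-powSum 2 f) (trans (cong₂ (λ a b → j′ + a + b) xs↦m′ f↦53) (identity j′ m′))
      where
      identity : ∀ j′ m′ → j′ + m′ + 53 ≡ 10 + j′ + (43 + m′)
      identity = solve-∀
    |ys|≡10+j′ : length ys ≡ 10 + j′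
    |ys|≡10+j′ = begin
      length ys                                  ≡⟨ length-++ (replicate j′ 1) ⟩
      length (replicate j′ 1) + length (xs ++ f) ≡⟨ cong₂ _+_ (length-replicate j′) (length-++ xs) ⟩
      j′ + (length xs + length f)                ≡⟨ cong (j′ +_) (trans (+-comm (length xs) _) |f|+k≡10) ⟩
      j′ + 10                                    ≡⟨ +-comm j′ 10 ⟩
      10 + j′                                    ∎
      where open ≡-Reasoning
    bounds : All (λ x → 1 ≤ x × x ≤ 10 + j′ + (43 + m′)) ys
    bounds = All.zip (All.++⁺ (All.replicate⁺ j′ ≤-refl) (All.++⁺ xs-pos f-pos) ,
                      subst (λ n → All (_≤ n) ys) ys↦n (All-≤-powSum 1 ys))

  fillers-representations : length xs ≤ 4 → 4 ≤ p 2 (10 + j′ + (43 + m′)) (10 + j′)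
  fillers-representations k≤4 = from-fillers (fillers-valid (s≤s k≤4))
    where
    fs : List (List ℕ)
    fs = fillers (length xs)
    powSum⁴-determined : ∀ {f g} → representation f ≡ representation g → powSum 4 f ≡ powSum 4 g
    powSum⁴-determined {f} {g} eq = +-cancelˡ-≡ (j′ + powSum 4 xs) _ _
      (trans (sym (representation-powSum 4 f)) (trans (cong (powSum 4) eq) (representation-powSum 4 g)))
    from-fillers : length fs ≡ 4 × All (Filler (length xs)) fs × Unique (map (powSum 4) fs) →
                   4 ≤ p 2 (10 + j′ + (43 + m′)) (10 + j′)
    from-fillers (|fs|≡4 , fs-valid , fs-unique) = begin
      4                              ≡⟨ |fs|≡4 ⟨
      length fs                      ≡⟨ length-map representation fs ⟨
      length (map representation fs) ≤⟨ distinct-representations≤p {2} (Unique-map-reflect powSum⁴-determined fs-unique)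
                                                                    (All.map⁺ (All.map representation-valid fs-valid)) ⟩
      p 2 (10 + j′ + (43 + m′)) (10 + j′) ∎
      where open ≤-Reasoning

p-large-excess : ∀ {j m} → 10 ≤ j → 43 ≤ m → 4 ≤ p 2 (j + m) j
p-large-excess {j} {m} 10≤j 43≤m =
  subst₂ (λ j m → 4 ≤ p 2 (j + m) j) (m+[n∸m]≡n 10≤j) (m+[n∸m]≡n 43≤m)
         (from-squares (sum-of-four-positive-squares (m ∸ 43)))
  where
  from-squares : ∃[ xs ] length xs ≤ 4 × All (1 ≤_) xs × powSum 2 xs ≡ m ∸ 43 →
                 4 ≤ p 2 (10 + (j ∸ 10) + (43 + (m ∸ 43))) (10 + (j ∸ 10))
  from-squares (xs , k≤4 , xs-pos , xs↦m′) = fillers-representations {j ∸ 10} xs-pos xs↦m′ k≤4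

theorem1p2 : (j : ℕ) → 10 ≤ j → (n : ℕ) → 1 ≤ n → p 2 n j ≢ 3
theorem1p2 j 10≤j n _ with n <? j
... | yes n<j = λ p≡3 → 0≢3 (trans (sym (trans (p≡p≤ 2 n j) (p≤≡0 2 n n<j))) p≡3)
  where 0≢3 : 0 ≢ 3
        0≢3 ()
... | no n≮j = subst (λ n → p 2 n j ≢ 3) (m+[n∸m]≡n (≮⇒≥ n≮j)) (excess (n ∸ j))
  where
  excess : ∀ m → p 2 (j + m) j ≢ 3
  excess m with m ≤? 42
  ... | yes m≤42 = p-small-excess 10≤j m≤42
  ... | no m≰42 = λ p≡3 → <⇒≱ (n<1+n 3) (subst (4 ≤_) p≡3 (p-large-excess 10≤j (≰⇒> m≰42)))
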